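{- Consider $\widetilde{\mathrm{SL}}_{r+1}^{(n)}$ with $Q(\alpha^\vee)=1$ for all coroots and $n\ge r+3$. Let $y\in Y$ be the element with $\mathbf i_A^*(y_\rho)=(0,1,2,\dots,r)$ (namely $y=0$). Then the orbit $\mathcal O_y$ is $Y_{Q,n}$-free.
   Context: $r\ge1$, $n\ge1$. $Y=\bigoplus_{i=1}^r\mathbb Z\alpha_i^\vee$ is the coroot (= cocharacter) lattice of $\mathrm{SL}_{r+1}$ with simple coroots in Dynkin order, and $W\cong S_{r+1}$ its Weyl group. $Q$ is the $W$-invariant quadratic form with $Q(\alpha^\vee)=1$ for all coroots, $B_Q(y,y')=Q(y+y')-Q(y)-Q(y')$, and $Y_{Q,n}=\{y\in Y:B_Q(y,y')\in n\mathbb Z\ \forall y'\in Y\}$. $\rho$ is half the sum of positive coroots, $y_\rho=y-\rho$, and $W$ acts on $Y$ by $w[y]=w(y_\rho)+\rho$, with orbits $\mathcal O_y$. An orbit is $Y_{Q,n}$-free if it has $|W|$ elements and $Y\to Y/Y_{Q,n}$ is injective on it. For $y=\sum_i x_i\alpha_i^\vee$, $\mathbf i_A^*(y_\rho)=(x_1,\,x_2-x_1+1,\,\dots,\,x_i-x_{i-1}+(i-1),\,\dots,\,-x_r+r)\in\mathbb Z^{r+1}$. -}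

module Defs where

open import Data.Nat as ℕ using (ℕ; zero; suc; _<?_)
open import Data.Fin using (Fin; toℕ; fromℕ<)
open import Data.Integer using (ℤ; +_; _+_; _-_; _*_; -_)
open import Data.Integer.Divisibility using (_∣_)
open import Data.List using (List; foldr)
open import Relation.Nullary using (yes; no)
open import Relation.Binary.PropositionalEquality using (_≡_)

-- Coroot lattice Y of SL_{r+1}: y = Σ_i x_i α_i^∨ is represented by its
-- coordinate vector (x_1,…,x_r), stored 0-indexed as Fin r → ℤ.
Y : ℕ → Set
Y r = Fin r → ℤ

-- 1-indexed coordinate with the convention x_0 = x_{r+1} = … = 0.
coord : ∀ {r} → Y r → ℕ → ℤ
coord {r} y zero = + 0
coord {r} y (suc j) with j <? r
... | yes j<r = y (fromℕ< j<r)
... | no _ = + 0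

Σ< : ℕ → (ℕ → ℤ) → ℤ
Σ< zero f = + 0
Σ< (suc m) f = Σ< m f + f m

_+Y_ : ∀ {r} → Y r → Y r → Y r
(y +Y z) i = y i + z i

_-Y_ : ∀ {r} → Y r → Y r → Y r
(y -Y z) i = y i - z i

_·Y_ : ∀ {r} → ℤ → Y r → Y r
(k ·Y y) i = k * y i

-- The W-invariant quadratic form with Q(α^∨) = 1 for all coroots (type A_r):
-- Q(y) = Σ_i x_i² − Σ_i x_i x_{i+1}.
Q : ∀ {r} → Y r → ℤ
Q {r} y = Σ< (suc r) (λ j → coord y j * coord y j)
          - Σ< (suc r) (λ j → coord y j * coord y (suc j))

BQ : ∀ {r} → Y r → Y r → ℤ
BQ y z = Q (y +Y z) - Q y - Q z

InYQn : ∀ {r} → ℕ → Y r → Set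
InYQn {r} n y = ∀ (z : Y r) → (+ n) ∣ BQ y z

αv : ∀ {r} → Fin r → Y r
αv i j with toℕ i ℕ.≟ toℕ j
... | yes _ = + 1
... | no _ = + 0
  where open import Data.Nat using (_≟_)

-- simple reflection s_i(y) = y − (B_Q(α_i^∨, y)/Q(α_i^∨)) α_i^∨, Q(α_i^∨) = 1
sRefl : ∀ {r} → Fin r → Y r → Y r
sRefl i y = y -Y (BQ (αv i) y ·Y αv i)

-- dot action of s_i: s_i[y] = s_i(y − ρ) + ρ = s_i(y) + α_i^∨ (since s_i ρ = ρ − α_i^∨)
sDot : ∀ {r} → Fin r → Y r → Y r
sDot i y = sRefl i y +Y αv i

-- Elements of W are represented by words in the simple reflections;
-- w[y] for w = s_{i_1} ⋯ s_{i_k}.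
W-word : ℕ → Set
W-word r = List (Fin r)

dot : ∀ {r} → W-word r → Y r → Y r
dot w y = foldr sDot y w

-- two words represent the same element of W (W acts faithfully on Y)
SameInW : ∀ {r} → W-word r → W-word r → Set
SameInW {r} u v = ∀ (z : Y r) (j : Fin r) → dot u z j ≡ dot v z j

-- O_y is Y_{Q,n}-free: |O_y| = |W| (trivial stabiliser) and O_y → Y/Y_{Q,n} injective;
-- equivalently: w[y] ≡ w'[y] mod Y_{Q,n} implies w = w' in W.
YQnFree : ∀ {r} → ℕ → Y r → Set
YQnFree {r} n y = ∀ (u v : W-word r) → InYQn n (dot u y -Y dot v y) → SameInW u v

-- i_A^*(y_ρ) = (x_1, x_2 − x_1 + 1, …, x_i − x_{i−1} + (i−1), …, −x_r + r), 0-indexed by k = i − 1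
iAρ : ∀ {r} → Y r → Fin (suc r) → ℤ
iAρ y k = coord y (suc (toℕ k)) - coord y (toℕ k) + (+ toℕ k)

module Submission where

open import Defs

-- In the coordinates iAρ the dot action of a simple reflection s_i swaps the
-- entries i and i+1, so a word w sends the point with coordinates (0,1,…,r) to
-- the one with coordinates (σ 0,…,σ r), σ the permutation of w.  Moreover
-- B_Q(α_i^∨, y) is the difference of the first differences Δ of y at i and i+1,
-- so u[y] ≡ v[y] modulo Y_{Q,n} makes σ k − τ k independent of k modulo n.
-- Looking at k₀ = τ⁻¹ 0: if σ k₀ = 0 then σ k ≡ τ k mod n and both lie in
-- [0, r] with r < n; if σ k₀ = b + 1, then at k = σ⁻¹ b the difference drops by
-- τ k + 1 ∈ [1, r + 1], which is impossible for n > r + 1.  Hence σ = τ, and as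
-- y is recovered from its iAρ coordinates, u and v act identically on Y.

module DotAction where
  open import Data.Nat as ℕ using (ℕ; zero; suc; _<_; _<?_)
  import Data.Nat.Properties as ℕ
  open import Data.Nat.Divisibility as ℕ using (>⇒∤)
  open import Data.Fin using (Fin; zero; suc; toℕ; fromℕ<; inject₁)
  open import Data.Fin.Properties as Fin
    using (toℕ<n; toℕ-fromℕ<; fromℕ<-toℕ; toℕ-inject₁; toℕ-injective)
  open import Data.Fin.Permutation as Perm
    using (Permutation′; _⟨$⟩ʳ_; _⟨$⟩ˡ_; inverseʳ; transpose; _∘ₚ_)
  open import Data.Integer as ℤ using (ℤ; +_; _+_; _-_; _*_; ∣_∣)
  import Data.Integer.Properties as ℤ
  open import Data.Integer.Divisibility.Signed
    using (_∣_; divides; ∣ᵤ⇒∣; ∣⇒∣ᵤ; ∣m∣n⇒∣m+n; ∣m∣n⇒∣m-n)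
  open import Data.Integer.Tactic.RingSolver using (solve-∀)
  open import Algebra.Properties.AbelianGroup ℤ.+-0-abelianGroup
    using () renaming (∙-cancelʳ to +-cancelʳ)
  open import Data.List using ([]; _∷_)
  open import Function using (_∘_)
  open import Relation.Nullary using (yes; no; contradiction)
  open import Relation.Binary.PropositionalEquality

  Σ<-cong : ∀ m {f g : ℕ → ℤ} → (∀ j → f j ≡ g j) → Σ< m f ≡ Σ< m g
  Σ<-cong zero    f≗g = refl
  Σ<-cong (suc m) f≗g = cong₂ _+_ (Σ<-cong m f≗g) (f≗g m)

  Σ<-distrib-minus : ∀ m (f g : ℕ → ℤ) → Σ< m (λ j → f j - g j) ≡ Σ< m f - Σ< m g
  Σ<-distrib-minus zero    f g = refl
  Σ<-distrib-minus (suc m) f g =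
    trans (cong (_+ (f m - g m)) (Σ<-distrib-minus m f g)) (swap (Σ< m f) (Σ< m g) (f m) (g m))
    where
    swap : ∀ s t a b → (s - t) + (a - b) ≡ (s + a) - (t + b)
    swap = solve-∀

  δ : ℕ → ℕ → ℤ
  δ zero    zero    = + 1
  δ zero    (suc _) = + 0
  δ (suc _) zero    = + 0
  δ (suc j) (suc p) = δ j p

  δ-refl : ∀ j → δ j j ≡ + 1
  δ-refl zero    = refl
  δ-refl (suc j) = δ-refl j

  δ-≢ : ∀ {j p} → j ≢ p → δ j p ≡ + 0
  δ-≢ {zero}  {zero}  j≢p = contradiction refl j≢p
  δ-≢ {zero}  {suc p} j≢p = refl
  δ-≢ {suc j} {zero}  j≢p = refl
  δ-≢ {suc j} {suc p} j≢p = δ-≢ (j≢p ∘ cong suc)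

  Σ<-δ-≤ : ∀ {m p} (g : ℕ → ℤ) → m ℕ.≤ p → Σ< m (λ j → δ j p * g j) ≡ + 0
  Σ<-δ-≤ {zero}      g m≤p = refl
  Σ<-δ-≤ {suc m} {p} g m<p rewrite δ-≢ (ℕ.<⇒≢ m<p) | Σ<-δ-≤ g (ℕ.<⇒≤ m<p) =
    ℤ.*-zeroˡ (g m)

  Σ<-δ : ∀ {m p} (g : ℕ → ℤ) → p < m → Σ< m (λ j → δ j p * g j) ≡ g p
  Σ<-δ {suc m} {p} g p<1+m with p ℕ.≟ m
  ... | yes refl rewrite Σ<-δ-≤ g (ℕ.≤-refl {p}) | δ-refl p =
    trans (ℤ.+-identityˡ (+ 1 * g p)) (ℤ.*-identityˡ (g p))
  ... | no p≢m rewrite δ-≢ (p≢m ∘ sym) | Σ<-δ g (ℕ.≤∧≢⇒< (ℕ.s≤s⁻¹ p<1+m) p≢m) =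
    trans (cong (λ t → g p + t) (ℤ.*-zeroˡ (g m))) (ℤ.+-identityʳ (g p))

  coord-cong : ∀ {r} {y z : Y r} → (∀ i → y i ≡ z i) → ∀ j → coord y j ≡ coord z j
  coord-cong     y≗z zero = refl
  coord-cong {r} y≗z (suc j) with j <? r
  ... | yes _ = y≗z _
  ... | no  _ = refl

  coord-zipWith : ∀ {r} (f : ℤ → ℤ → ℤ) → f (+ 0) (+ 0) ≡ + 0 → {y z w : Y r} →
    (∀ i → w i ≡ f (y i) (z i)) → ∀ j → coord w j ≡ f (coord y j) (coord z j)
  coord-zipWith     f f00 w≗f zero = sym f00
  coord-zipWith {r} f f00 w≗f (suc j) with j <? r
  ... | yes _ = w≗f _
  ... | no  _ = sym f00

  coord-suc-toℕ : ∀ {r} (y : Y r) (j : Fin r) → coord y (suc (toℕ j)) ≡ y j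
  coord-suc-toℕ {r} y j with toℕ j <? r
  ... | yes j<r = cong y (fromℕ<-toℕ j j<r)
  ... | no  j≮r = contradiction (toℕ<n j) j≮r

  coord-αv : ∀ {r} (i : Fin r) j → coord (αv i) j ≡ δ j (suc (toℕ i))
  coord-αv     i zero = refl
  coord-αv {r} i (suc j) with j <? r
  ... | yes j<r = trans (αv≡δ (fromℕ< j<r)) (cong (λ k → δ k (toℕ i)) (toℕ-fromℕ< j<r))
    where
    αv≡δ : ∀ k → αv i k ≡ δ (toℕ k) (toℕ i)
    αv≡δ k with toℕ i ℕ.≟ toℕ k
    ... | yes i≡k = sym (trans (cong (δ (toℕ k)) i≡k) (δ-refl (toℕ k)))
    ... | no  i≢k = sym (δ-≢ (i≢k ∘ sym))
  ... | no  j≮r = sym (δ-≢ λ j≡i → j≮r (subst (_< r) (sym j≡i) (toℕ<n i)))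

  quadSum : ℕ → (ℕ → ℤ) → ℤ
  quadSum m x = Σ< m (λ j → x j * x j) - Σ< m (λ j → x j * x (suc j))

  polarSum : ℕ → (ℕ → ℤ) → (ℕ → ℤ) → ℤ
  polarSum m x z = Σ< m (λ j → x j * z j + x j * z j - x j * z (suc j) - x (suc j) * z j)

  quadSum-cong : ∀ m {x z : ℕ → ℤ} → (∀ j → x j ≡ z j) → quadSum m x ≡ quadSum m z
  quadSum-cong m x≗z =
    cong₂ _-_ (Σ<-cong m (λ j → cong₂ _*_ (x≗z j) (x≗z j)))
              (Σ<-cong m (λ j → cong₂ _*_ (x≗z j) (x≗z (suc j))))

  quadSum-polarisation : ∀ m (x z : ℕ → ℤ) →
    quadSum m (λ j → x j + z j) - quadSum m x - quadSum m z ≡ polarSum m x z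
  quadSum-polarisation zero    x z = refl
  quadSum-polarisation (suc m) x z =
    trans (step (Σ< m (λ j → (x j + z j) * (x j + z j)))
                (Σ< m (λ j → (x j + z j) * (x (suc j) + z (suc j))))
                (Σ< m (λ j → x j * x j)) (Σ< m (λ j → x j * x (suc j)))
                (Σ< m (λ j → z j * z j)) (Σ< m (λ j → z j * z (suc j)))
                (x m) (x (suc m)) (z m) (z (suc m)))
          (cong (_+ (x m * z m + x m * z m - x m * z (suc m) - x (suc m) * z m))
                (quadSum-polarisation m x z))
    where
    step : ∀ s₁ s₂ s₃ s₄ s₅ s₆ a a′ b b′ →
      ((s₁ + (a + b) * (a + b)) - (s₂ + (a + b) * (a′ + b′)))
        - ((s₃ + a * a) - (s₄ + a * a′)) - ((s₅ + b * b) - (s₆ + b * b′))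
      ≡ (((s₁ - s₂) - (s₃ - s₄)) - (s₅ - s₆)) + (a * b + a * b - a * b′ - a′ * b)
    step = solve-∀

  BQ≡polarSum : ∀ {r} (y z : Y r) → BQ y z ≡ polarSum (suc r) (coord y) (coord z)
  BQ≡polarSum {r} y z =
    trans (cong (λ q → q - Q y - Q z)
                (quadSum-cong (suc r) (coord-zipWith _+_ refl (λ _ → refl))))
          (quadSum-polarisation (suc r) (coord y) (coord z))

  BQ-comm : ∀ {r} (y z : Y r) → BQ y z ≡ BQ z y
  BQ-comm {r} y z =
    trans (cong (λ q → q - Q y - Q z)
                (quadSum-cong (suc r) (coord-cong (λ i → ℤ.+-comm (y i) (z i)))))
          (swap (Q (z +Y y)) (Q y) (Q z))
    where
    swap : ∀ a b c → a - b - c ≡ a - c - b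
    swap = solve-∀

  -- iAρ y k unfolds to Δ y (toℕ k) + + toℕ k.
  Δ : ∀ {r} → Y r → ℕ → ℤ
  Δ y j = coord y (suc j) - coord y j

  BQ-αv : ∀ {r} (i : Fin r) (y : Y r) → BQ (αv i) y ≡ Δ y (toℕ i) - Δ y (suc (toℕ i))
  BQ-αv {r} i y = begin
    BQ (αv i) y
      ≡⟨ BQ≡polarSum (αv i) y ⟩
    polarSum (suc r) (coord (αv i)) c
      ≡⟨ Σ<-cong (suc r) (λ j →
           trans (cong₂ (λ d d′ → d * c j + d * c j - d * c (suc j) - d′ * c j)
                        (coord-αv i j) (coord-αv i (suc j)))
                 (regroup (δ j p) (δ j i′) (c j) (c (suc j)))) ⟩
    Σ< (suc r) (λ j → δ j p * (c j + c j - c (suc j)) - δ j i′ * c j)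
      ≡⟨ Σ<-distrib-minus (suc r) (λ j → δ j p * (c j + c j - c (suc j)))
                                  (λ j → δ j i′ * c j) ⟩
    Σ< (suc r) (λ j → δ j p * (c j + c j - c (suc j))) - Σ< (suc r) (λ j → δ j i′ * c j)
      ≡⟨ cong₂ _-_ (Σ<-δ (λ j → c j + c j - c (suc j)) (ℕ.s≤s (toℕ<n i)))
                   (Σ<-δ c (ℕ.m<n⇒m<1+n (toℕ<n i))) ⟩
    (c p + c p - c (suc p)) - c i′
      ≡⟨ differences (c i′) (c p) (c (suc p)) ⟩
    Δ y i′ - Δ y p ∎
    where
    open ≡-Reasoning
    i′ = toℕ i
    p = suc i′
    c = coord y
    regroup : ∀ d d′ a b → d * a + d * a - d * b - d′ * a ≡ d * (a + a - b) - d′ * a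
    regroup = solve-∀
    differences : ∀ a b c → (b + b - c) - a ≡ (b - a) - (c - b)
    differences = solve-∀

  coord-sDot : ∀ {r} (i : Fin r) (y : Y r) j →
    coord (sDot i y) j ≡ coord y j - BQ (αv i) y * δ j (suc (toℕ i)) + δ j (suc (toℕ i))
  coord-sDot i y j =
    trans (coord-zipWith (λ a d → a - b * d + d) (vanish b) (λ _ → refl) j)
          (cong (λ d → coord y j - b * d + d) (coord-αv i j))
    where
    b = BQ (αv i) y
    vanish : ∀ b → + 0 - b * + 0 + + 0 ≡ + 0
    vanish = solve-∀

  module _ {r} (i : Fin r) (y : Y r) where
    private
      i′ p : ℕ
      i′ = toℕ i
      p = suc i′
      c s : ℕ → ℤ
      c = coord y
      s = coord (sDot i y)
      b : ℤ
      b = BQ (αv i) y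

    Δ-sDot-at : Δ (sDot i y) i′ ≡ Δ y p + + 1
    Δ-sDot-at = begin
      s p - s i′
        ≡⟨ cong₂ _-_ (coord-sDot i y p) (coord-sDot i y i′) ⟩
      (c p - b * δ p p + δ p p) - (c i′ - b * δ i′ p + δ i′ p)
        ≡⟨ cong₂ (λ d d′ → (c p - b * d + d) - (c i′ - b * d′ + d′))
                 (δ-refl p) (δ-≢ (ℕ.1+n≢n {i′} ∘ sym)) ⟩
      (c p - b * + 1 + + 1) - (c i′ - b * + 0 + + 0)
        ≡⟨ cong (λ b → (c p - b * + 1 + + 1) - (c i′ - b * + 0 + + 0)) (BQ-αv i y) ⟩
      _ ≡⟨ simplify (c i′) (c p) (c (suc p)) ⟩
      Δ y p + + 1 ∎
      where
      open ≡-Reasoning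
      simplify : ∀ a₀ a₁ a₂ → (a₁ - ((a₁ - a₀) - (a₂ - a₁)) * + 1 + + 1)
                           - (a₀ - ((a₁ - a₀) - (a₂ - a₁)) * + 0 + + 0) ≡ (a₂ - a₁) + + 1
      simplify = solve-∀

    Δ-sDot-after : Δ (sDot i y) p + + 1 ≡ Δ y i′
    Δ-sDot-after = begin
      s (suc p) - s p + + 1
        ≡⟨ cong₂ (λ u v → u - v + + 1) (coord-sDot i y (suc p)) (coord-sDot i y p) ⟩
      (c (suc p) - b * δ p i′ + δ p i′) - (c p - b * δ p p + δ p p) + + 1
        ≡⟨ cong₂ (λ d d′ → (c (suc p) - b * d + d) - (c p - b * d′ + d′) + + 1)
                 (δ-≢ (ℕ.1+n≢n {i′})) (δ-refl p) ⟩
      (c (suc p) - b * + 0 + + 0) - (c p - b * + 1 + + 1) + + 1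
        ≡⟨ cong (λ b → (c (suc p) - b * + 0 + + 0) - (c p - b * + 1 + + 1) + + 1)
                (BQ-αv i y) ⟩
      _ ≡⟨ simplify (c i′) (c p) (c (suc p)) ⟩
      Δ y i′ ∎
      where
      open ≡-Reasoning
      simplify : ∀ a₀ a₁ a₂ → (a₂ - ((a₁ - a₀) - (a₂ - a₁)) * + 0 + + 0)
                           - (a₁ - ((a₁ - a₀) - (a₂ - a₁)) * + 1 + + 1) + + 1 ≡ a₁ - a₀
      simplify = solve-∀

    Δ-sDot-away : ∀ {j} → j ≢ i′ → j ≢ p → Δ (sDot i y) j ≡ Δ y j
    Δ-sDot-away {j} j≢i′ j≢p = begin
      s (suc j) - s j
        ≡⟨ cong₂ _-_ (coord-sDot i y (suc j)) (coord-sDot i y j) ⟩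
      (c (suc j) - b * δ j i′ + δ j i′) - (c j - b * δ j p + δ j p)
        ≡⟨ cong₂ (λ d d′ → (c (suc j) - b * d + d) - (c j - b * d′ + d′))
                 (δ-≢ j≢i′) (δ-≢ j≢p) ⟩
      (c (suc j) - b * + 0 + + 0) - (c j - b * + 0 + + 0)
        ≡⟨ simplify (c j) (c (suc j)) b ⟩
      Δ y j ∎
      where
      open ≡-Reasoning
      simplify : ∀ a₀ a₁ b → (a₁ - b * + 0 + + 0) - (a₀ - b * + 0 + + 0) ≡ a₁ - a₀
      simplify = solve-∀

  transposition : ∀ {r} → Fin r → Permutation′ (suc r)
  transposition i = transpose (inject₁ i) (suc i)

  iAρ-sDot : ∀ {r} (i : Fin r) (y : Y r) k → iAρ (sDot i y) k ≡ iAρ y (transposition i ⟨$⟩ʳ k)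
  iAρ-sDot i y k with k Fin.≟ inject₁ i
  ... | yes refl rewrite toℕ-inject₁ i =
    trans (cong (_+ + toℕ i) (Δ-sDot-at i y))
          (ℤ.+-assoc (Δ y (suc (toℕ i))) (+ 1) (+ toℕ i))
  ... | no k≢i with k Fin.≟ suc i
  ...   | yes refl rewrite toℕ-inject₁ i =
    trans (sym (ℤ.+-assoc (Δ (sDot i y) (suc (toℕ i))) (+ 1) (+ toℕ i)))
          (cong (_+ + toℕ i) (Δ-sDot-after i y))
  ...   | no k≢1+i = cong (_+ + toℕ k) (Δ-sDot-away i y
    (λ k≡i → k≢i (toℕ-injective (trans k≡i (sym (toℕ-inject₁ i)))))
    (k≢1+i ∘ toℕ-injective))

  permutationOf : ∀ {r} → W-word r → Permutation′ (suc r)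
  permutationOf []      = Perm.id
  permutationOf (i ∷ w) = transposition i ∘ₚ permutationOf w

  iAρ-dot : ∀ {r} (w : W-word r) (y : Y r) k → iAρ (dot w y) k ≡ iAρ y (permutationOf w ⟨$⟩ʳ k)
  iAρ-dot []      y k = refl
  iAρ-dot (i ∷ w) y k = trans (iAρ-sDot i (dot w y) k) (iAρ-dot w y (transposition i ⟨$⟩ʳ k))

  iAρ-sub : ∀ {r} (y z : Y r) k → iAρ y k - iAρ z k ≡ Δ (y -Y z) (toℕ k)
  iAρ-sub y z k = begin
    (Δ y m + + m) - (Δ z m + + m)
      ≡⟨ cancel (coord y (suc m)) (coord y m) (coord z (suc m)) (coord z m) (+ m) ⟩
    (coord y (suc m) - coord z (suc m)) - (coord y m - coord z m)
      ≡⟨ sym (cong₂ _-_ (coord-zipWith _-_ refl {y} {z} (λ _ → refl) (suc m))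
                        (coord-zipWith _-_ refl {y} {z} (λ _ → refl) m)) ⟩
    Δ (y -Y z) m ∎
    where
    open ≡-Reasoning
    m = toℕ k
    cancel : ∀ a₁ a₀ b₁ b₀ t → ((a₁ - a₀) + t) - ((b₁ - b₀) + t) ≡ (a₁ - b₁) - (a₀ - b₀)
    cancel = solve-∀

  Δ-≡⇒coord-≡ : ∀ {r} {y z : Y r} m → (∀ j → j < m → Δ y j ≡ Δ z j) → coord y m ≡ coord z m
  Δ-≡⇒coord-≡ zero    Δy≡Δz = refl
  Δ-≡⇒coord-≡ {y = y} {z} (suc m) Δy≡Δz = begin
    coord y (suc m)     ≡⟨ sym (restore (coord y (suc m)) (coord y m)) ⟩
    Δ y m + coord y m   ≡⟨ cong₂ _+_ (Δy≡Δz m ℕ.≤-refl)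
                                     (Δ-≡⇒coord-≡ m (λ j → Δy≡Δz j ∘ ℕ.m<n⇒m<1+n)) ⟩
    Δ z m + coord z m   ≡⟨ restore (coord z (suc m)) (coord z m) ⟩
    coord z (suc m)     ∎
    where
    open ≡-Reasoning
    restore : ∀ a b → (a - b) + b ≡ a
    restore = solve-∀

  iAρ-injective : ∀ {r} {y z : Y r} → (∀ k → iAρ y k ≡ iAρ z k) → ∀ j → y j ≡ z j
  iAρ-injective {r} {y} {z} iAρy≡iAρz j =
    trans (sym (coord-suc-toℕ y j))
          (trans (Δ-≡⇒coord-≡ {y = y} {z} (suc (toℕ j)) Δy≡Δz) (coord-suc-toℕ z j))
    where
    Δy≡Δz : ∀ m → m < suc (toℕ j) → Δ y m ≡ Δ z m
    Δy≡Δz m m≤j = +-cancelʳ (+ m) (Δ y m) (Δ z m) (begin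
      Δ y m + + m  ≡⟨ cong (iAρ-at y) (toℕ-fromℕ< m<1+r) ⟨
      iAρ y k      ≡⟨ iAρy≡iAρz k ⟩
      iAρ z k      ≡⟨ cong (iAρ-at z) (toℕ-fromℕ< m<1+r) ⟩
      Δ z m + + m  ∎)
      where
      open ≡-Reasoning
      iAρ-at : Y r → ℕ → ℤ
      iAρ-at x m = Δ x m + + m
      m<1+r : m < suc r
      m<1+r = ℕ.m<n⇒m<1+n (ℕ.<-≤-trans m≤j (toℕ<n j))
      k : Fin (suc r)
      k = fromℕ< m<1+r

  small-congruent⇒≡ : ∀ {n x y} → x < n → y < n → + n ∣ + x - + y → x ≡ y
  small-congruent⇒≡ {n} {x} {y} x<n y<n n∣x-y =
    ℤ.+-injective (ℤ.i-j≡0⇒i≡j (+ x) (+ y)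
      (ℤ.∣i∣≡0⇒i≡0 (bounded-multiple (∣⇒∣ᵤ n∣x-y) gap<n)))
    where
    gap<n : ∣ + x - + y ∣ < n
    gap<n = subst (_< n) (cong ∣_∣ (sym (ℤ.[+m]-[+n]≡m⊖n x y)))
                  (ℕ.≤-<-trans (ℤ.∣m⊝n∣≤m⊔n x y) (ℕ.⊔-pres-<m x<n y<n))
    bounded-multiple : ∀ {m} → n ℕ.∣ m → m < n → m ≡ 0
    bounded-multiple {zero}  _   _   = refl
    bounded-multiple {suc m} n∣m m<n = contradiction n∣m (>⇒∤ m<n)

  ∣-differences-of-chain : ∀ {r} {d : ℤ} (f : Fin (suc r) → ℤ) →
    (∀ i → d ∣ f (inject₁ i) - f (suc i)) → ∀ k l → d ∣ f k - f l
  ∣-differences-of-chain {d = d} f consecutive k l =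
    subst (d ∣_) (swap (f zero) (f k) (f l))
          (∣m∣n⇒∣m-n (from-zero f consecutive l) (from-zero f consecutive k))
    where
    swap : ∀ a b c → (a - c) - (a - b) ≡ b - c
    swap = solve-∀
    from-zero : ∀ {r} (f : Fin (suc r) → ℤ) →
      (∀ i → d ∣ f (inject₁ i) - f (suc i)) → ∀ k → d ∣ f zero - f k
    from-zero f consecutive zero =
      divides (+ 0) (trans (ℤ.+-inverseʳ (f zero)) (sym (ℤ.*-zeroˡ d)))
    from-zero {suc r} f consecutive (suc k) =
      subst (d ∣_) (ℤ.+-minus-telescope (f zero) (f (suc zero)) (f (suc k)))
            (∣m∣n⇒∣m+n (consecutive zero) (from-zero (f ∘ suc) (consecutive ∘ suc) k))

  gap : ∀ {m} → Permutation′ m → Permutation′ m → Fin m → ℤ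
  gap σ τ k = + toℕ (σ ⟨$⟩ʳ k) - + toℕ (τ ⟨$⟩ʳ k)

  gap-constant-mod⇒≈ : ∀ {r n} (σ τ : Permutation′ (suc r)) → suc r < n →
    (∀ k l → + n ∣ gap σ τ k - gap σ τ l) → σ Perm.≈ τ
  gap-constant-mod⇒≈ {r} {n} σ τ 1+r<n gap-const = σ≈τ (σ ⟨$⟩ʳ k₀) refl
    where
    open ≡-Reasoning
    bound : ∀ (π : Permutation′ (suc r)) k → toℕ (π ⟨$⟩ʳ k) < n
    bound π k = ℕ.<-trans (toℕ<n (π ⟨$⟩ʳ k)) 1+r<n
    k₀ : Fin (suc r)
    k₀ = τ ⟨$⟩ˡ zero
    gap-k₀ : ∀ {s} → σ ⟨$⟩ʳ k₀ ≡ s → gap σ τ k₀ ≡ + toℕ s - + 0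
    gap-k₀ σk₀≡s = cong₂ (λ s t → + toℕ s - + toℕ t) σk₀≡s (inverseʳ τ)
    σ≈τ : ∀ s → σ ⟨$⟩ʳ k₀ ≡ s → σ Perm.≈ τ
    σ≈τ zero σk₀≡0 k =
      toℕ-injective (small-congruent⇒≡ (bound σ k) (bound τ k)
        (subst (+ n ∣_) gap-k₀-vanishes (gap-const k k₀)))
      where
      gap-k₀-vanishes : gap σ τ k - gap σ τ k₀ ≡ gap σ τ k
      gap-k₀-vanishes = trans (cong (gap σ τ k -_) (gap-k₀ σk₀≡0)) (ℤ.+-identityʳ (gap σ τ k))
    σ≈τ (suc b) σk₀≡1+b = contradiction 0≡1+t λ ()
      where
      k = σ ⟨$⟩ˡ inject₁ b
      t = toℕ (τ ⟨$⟩ʳ k)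
      shift : ∀ x t → (x - t) - ((+ 1 + x) - + 0) ≡ + 0 - (+ 1 + t)
      shift = solve-∀
      gap-difference : gap σ τ k - gap σ τ k₀ ≡ + 0 - + suc t
      gap-difference = begin
        gap σ τ k - gap σ τ k₀
          ≡⟨ cong₂ (λ x g → (+ x - + t) - g)
                   (trans (cong toℕ (inverseʳ σ)) (toℕ-inject₁ b)) (gap-k₀ σk₀≡1+b) ⟩
        (+ toℕ b - + t) - (+ suc (toℕ b) - + 0)
          ≡⟨ shift (+ toℕ b) (+ t) ⟩
        + 0 - + suc t ∎
      0≡1+t : 0 ≡ suc t
      0≡1+t = small-congruent⇒≡ (ℕ.<-trans ℕ.z<s 1+r<n)
                                (ℕ.≤-<-trans (toℕ<n (τ ⟨$⟩ʳ k)) 1+r<n)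
                                (subst (+ n ∣_) gap-difference (gap-const k k₀))

  module _ {r} {y : Y r} (iAρy≡id : ∀ k → iAρ y k ≡ + toℕ k) (u v : W-word r) where
    private
      σ τ : Permutation′ (suc r)
      σ = permutationOf u
      τ = permutationOf v
      d : Y r
      d = dot u y -Y dot v y

    gap≡Δ : ∀ k → gap σ τ k ≡ Δ d (toℕ k)
    gap≡Δ k = begin
      + toℕ (σ ⟨$⟩ʳ k) - + toℕ (τ ⟨$⟩ʳ k)
        ≡⟨ cong₂ _-_ (orbit u) (orbit v) ⟨
      iAρ (dot u y) k - iAρ (dot v y) k
        ≡⟨ iAρ-sub (dot u y) (dot v y) k ⟩
      Δ d (toℕ k) ∎
      where
      open ≡-Reasoning
      orbit : ∀ w → iAρ (dot w y) k ≡ + toℕ (permutationOf w ⟨$⟩ʳ k)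
      orbit w = trans (iAρ-dot w y k) (iAρy≡id (permutationOf w ⟨$⟩ʳ k))

    gap-consecutive-∣ : ∀ {n} → InYQn n d → ∀ i → + n ∣ gap σ τ (inject₁ i) - gap σ τ (suc i)
    gap-consecutive-∣ {n} n∣BQ i = subst (+ n ∣_) BQ≡gaps (∣ᵤ⇒∣ (n∣BQ (αv i)))
      where
      open ≡-Reasoning
      BQ≡gaps : BQ d (αv i) ≡ gap σ τ (inject₁ i) - gap σ τ (suc i)
      BQ≡gaps = begin
        BQ d (αv i)
          ≡⟨ BQ-comm d (αv i) ⟩
        BQ (αv i) d
          ≡⟨ BQ-αv i d ⟩
        Δ d (toℕ i) - Δ d (suc (toℕ i))
          ≡⟨ cong (λ m → Δ d m - Δ d (suc (toℕ i))) (toℕ-inject₁ i) ⟨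
        Δ d (toℕ (inject₁ i)) - Δ d (toℕ (suc i))
          ≡⟨ cong₂ _-_ (gap≡Δ (inject₁ i)) (gap≡Δ (suc i)) ⟨
        gap σ τ (inject₁ i) - gap σ τ (suc i) ∎

  ≈⇒SameInW : ∀ {r} (u v : W-word r) → permutationOf u Perm.≈ permutationOf v → SameInW u v
  ≈⇒SameInW u v σ≈τ z = iAρ-injective λ k → begin
    iAρ (dot u z) k                    ≡⟨ iAρ-dot u z k ⟩
    iAρ z (permutationOf u ⟨$⟩ʳ k)     ≡⟨ cong (iAρ z) (σ≈τ k) ⟩
    iAρ z (permutationOf v ⟨$⟩ʳ k)     ≡⟨ iAρ-dot v z k ⟨
    iAρ (dot v z) k                    ∎
    where open ≡-Reasoning

open DotAction

open import Data.Nat using (ℕ; suc; _≤_; _+_)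
import Data.Nat.Properties as ℕ
open import Data.Fin using (Fin; toℕ)
open import Data.Integer using (+_)
open import Relation.Binary.PropositionalEquality using (_≡_; subst)

lemma4p9 : (r n : ℕ) → 1 ≤ r → r + 3 ≤ n → (y : Y r) →
    (∀ (k : Fin (suc r)) → iAρ y k ≡ + (toℕ k)) →
    YQnFree n y
lemma4p9 r n _ r+3≤n y iAρy≡id u v n∣u[y]-v[y] =
  ≈⇒SameInW u v
    (gap-constant-mod⇒≈ (permutationOf u) (permutationOf v) r+2≤n
      (∣-differences-of-chain (gap (permutationOf u) (permutationOf v))
        (gap-consecutive-∣ iAρy≡id u v n∣u[y]-v[y])))
  where
  r+2≤n : suc (suc r) ≤ n
  r+2≤n = ℕ.≤-trans (ℕ.n≤1+n (suc (suc r))) (subst (_≤ n) (ℕ.+-comm r 3) r+3≤n)
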